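{- Let $Q_n=Q_n(x,y,z,t)$, $n\geq 1$, be the polynomials defined by $$Q_1=1,\qquad Q_{n+1}=\bigl[x+nz+(y+t)(n+y\,\partial_y)\bigr]Q_n \quad (n\ge 1),$$ where $\partial_y$ denotes partial differentiation with respect to $y$. Then for every $n\geq 1$, $$Q_n(x,y,z,t)=Q_n(x+nz+nt,\;y,\;-t,\;-z).$$ -}

module Defs where

open import Level using (Level)
open import Algebra.Bundles using (CommutativeRing)
open import Data.Nat using (ℕ; zero; suc)
open import Data.List using (List; []; _∷_; map)

-- Polynomials in the variable y with coefficients in a commutative ring R,
-- represented by coefficient lists (head = coefficient of y^0).
-- The other variables x, z, t are ring elements; since the identity is
-- required for EVERY commutative ring (in particular ℤ[x,y,z,t]) it is
-- exactly the polynomial identity of the paper.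
module Poly {c ℓ : Level} (R : CommutativeRing c ℓ) where
  open CommutativeRing R

  fromℕ : ℕ → Carrier
  fromℕ zero    = 0#
  fromℕ (suc m) = 1# + fromℕ m

  _⊕_ : List Carrier → List Carrier → List Carrier
  []       ⊕ bs       = bs
  (a ∷ as) ⊕ []       = a ∷ as
  (a ∷ as) ⊕ (b ∷ bs) = (a + b) ∷ (as ⊕ bs)

  scale : Carrier → List Carrier → List Carrier
  scale a = map (a *_)

  -- the operator (m + y ∂_y) : coefficient of y^k gets multiplied by m + k
  numOp : ℕ → List Carrier → List Carrier
  numOp m []       = []
  numOp m (a ∷ as) = (fromℕ m * a) ∷ numOp (suc m) as

  mulYplus : Carrier → List Carrier → List Carrier
  mulYplus t as = (0# ∷ as) ⊕ scale t as

  step : Carrier → Carrier → Carrier → ℕ → List Carrier → List Carrier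
  step x z t n as = scale (x + fromℕ n * z) as ⊕ mulYplus t (numOp n as)

  -- Q n x z t : coefficient list (in y) of Q_n(x,y,z,t), for n ≥ 1.
  -- Q 0 is a junk value (the theorem only concerns n ≥ 1).
  Q : ℕ → Carrier → Carrier → Carrier → List Carrier
  Q zero          x z t = []
  Q (suc zero)    x z t = 1# ∷ []
  Q (suc (suc n)) x z t = step x z t (suc n) (Q (suc n) x z t)

  eval : Carrier → List Carrier → Carrier
  eval y []       = 0#
  eval y (a ∷ as) = a + y * eval y as

{-# OPTIONS --safe #-}
module Submission where

open import Defs
open import Algebra.Bundles using (CommutativeRing)
open import Data.Nat as ℕ using (ℕ; zero; suc; _≤_)
open import Data.List using (List; []; _∷_)

-- With θ = y ∂_y and a = x + n z + n t, the operator x + n z + (y + t)(n + θ) reads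
-- T(a, t, n) = a + t θ + y (n + θ).  A direct computation, using θ y = y (θ + 1), gives
--   T(a, s, n + 1) T(b, u, n) = T(b, u, n + 1) T(a, s, n)   whenever a + n u = b + n s.
-- Since T(a, s, 1) 1 = a + y does not depend on s, this lets one carry the innermost factor
-- T(x + z + t, t, 1) of Q_{n+1}(x, z, t) through all the others, which yields
--   Q_{n+1}(x, z, t) = T(x + z + t, -z, n) Q_n(x + z + t, z, t).
-- The same factor T(x + z + t, -z, n) is the outermost one of Q_{n+1}(x + (n+1)(z+t), -t, -z),
-- so the theorem follows by induction on n.
module _ {c ℓ} (R : CommutativeRing c ℓ) where
  open CommutativeRing R hiding (zero)
  open Poly R
  open import Algebra.Properties.Ring ring using (+-cancelʳ; -‿distribʳ-*; //-rightDividesʳ)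
  open import Algebra.Properties.CommutativeSemigroup +-commutativeSemigroup using (xy∙z≈xz∙y)
  open import Algebra.Solver.Ring.NaturalCoefficients.Default commutativeSemiring
  open import Relation.Binary.Reasoning.Setoid setoid

  Coeffs : Set c
  Coeffs = ℕ → Carrier

  infix 4 _≐_
  _≐_ : Coeffs → Coeffs → Set ℓ
  f ≐ g = ∀ k → f k ≈ g k

  coeff : List Carrier → Coeffs
  coeff []       k       = 0#
  coeff (a ∷ as) zero    = a
  coeff (a ∷ as) (suc k) = coeff as k

  coeff-⊕ : ∀ f g → coeff (f ⊕ g) ≐ λ k → coeff f k + coeff g k
  coeff-⊕ []       g        k       = sym (+-identityˡ _)
  coeff-⊕ (a ∷ as) []       k       = sym (+-identityʳ _)
  coeff-⊕ (a ∷ as) (b ∷ bs) zero    = refl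
  coeff-⊕ (a ∷ as) (b ∷ bs) (suc k) = coeff-⊕ as bs k

  coeff-scale : ∀ a f → coeff (scale a f) ≐ λ k → a * coeff f k
  coeff-scale a []       k       = sym (zeroʳ a)
  coeff-scale a (b ∷ bs) zero    = refl
  coeff-scale a (b ∷ bs) (suc k) = coeff-scale a bs k

  coeff-numOp : ∀ m f → coeff (numOp m f) ≐ λ k → (fromℕ m + fromℕ k) * coeff f k
  coeff-numOp m []       k       = sym (zeroʳ _)
  coeff-numOp m (a ∷ as) zero    = *-congʳ (sym (+-identityʳ _))
  coeff-numOp m (a ∷ as) (suc k) = trans (coeff-numOp (suc m) as k) (*-congʳ (shift (fromℕ m) (fromℕ k)))
    where
    shift : ∀ a b → (1# + a) + b ≈ a + (1# + b)
    shift = solve 2 (λ a b → (con 1 :+ a) :+ b := a :+ (con 1 :+ b)) refl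

  -- On coefficient sequences, raise n is y (n + θ) and stepₛ a s n is T(a, s, n).
  raise : ℕ → Coeffs → Coeffs
  raise n f zero    = 0#
  raise n f (suc k) = (fromℕ n + fromℕ k) * f k

  stepₛ : Carrier → Carrier → ℕ → Coeffs → Coeffs
  stepₛ a s n f k = (a + fromℕ k * s) * f k + raise n f k

  α : Carrier → Carrier → Carrier → ℕ → Carrier
  α x z t n = x + fromℕ n * z + fromℕ n * t

  coeff-step : ∀ x z t n f → coeff (step x z t n f) ≐ stepₛ (α x z t n) t n (coeff f)
  coeff-step x z t n f k = begin
    coeff (step x z t n f) k
      ≈⟨ coeff-⊕ (scale (x + N * z) f) (mulYplus t g) k ⟩
    coeff (scale (x + N * z) f) k + coeff ((0# ∷ g) ⊕ scale t g) k
      ≈⟨ +-cong (coeff-scale _ f k) (coeff-⊕ (0# ∷ g) (scale t g) k) ⟩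
    (x + N * z) * coeff f k + (coeff (0# ∷ g) k + coeff (scale t g) k)
      ≈⟨ +-congˡ (+-cong (y*numOp k) (trans (coeff-scale t g k) (*-congˡ (coeff-numOp n f k)))) ⟩
    (x + N * z) * coeff f k + (raise n (coeff f) k + t * ((N + fromℕ k) * coeff f k))
      ≈⟨ collect x z t N (fromℕ k) (coeff f k) (raise n (coeff f) k) ⟩
    stepₛ (α x z t n) t n (coeff f) k ∎
    where
    N = fromℕ n
    g = numOp n f

    y*numOp : ∀ k → coeff (0# ∷ g) k ≈ raise n (coeff f) k
    y*numOp zero    = refl
    y*numOp (suc k) = coeff-numOp n f k

    collect : ∀ x z t N K a r → (x + N * z) * a + (r + t * ((N + K) * a)) ≈ (x + N * z + N * t + K * t) * a + r
    collect = solve 7 (λ x z t N K a r →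
      (x :+ N :* z) :* a :+ (r :+ t :* ((N :+ K) :* a)) := (x :+ N :* z :+ N :* t :+ K :* t) :* a :+ r) refl

  stepₛ-cong : ∀ {a a′ s s′} n {f g} → a ≈ a′ → s ≈ s′ → f ≐ g → stepₛ a s n f ≐ stepₛ a′ s′ n g
  stepₛ-cong n a≈a′ s≈s′ f≐g zero    = +-congʳ (*-cong (+-cong a≈a′ (*-congˡ s≈s′)) (f≐g zero))
  stepₛ-cong n a≈a′ s≈s′ f≐g (suc k) =
    +-cong (*-cong (+-cong a≈a′ (*-congˡ s≈s′)) (f≐g (suc k))) (*-congˡ (f≐g k))

  stepₛ-constant : ∀ a s s′ n b → stepₛ a s n (coeff (b ∷ [])) ≐ stepₛ a s′ n (coeff (b ∷ []))
  stepₛ-constant a s s′ n b zero    = +-congʳ (*-congʳ (+-congˡ (trans (zeroˡ s) (sym (zeroˡ s′)))))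
  stepₛ-constant a s s′ n b (suc k) = +-congʳ (trans (zeroʳ _) (sym (zeroʳ _)))

  stepₛ-comm : ∀ {a b s u} n → a + fromℕ n * u ≈ b + fromℕ n * s →
               ∀ f → stepₛ a s (suc n) (stepₛ b u n f) ≐ stepₛ b u (suc n) (stepₛ a s n f)
  stepₛ-comm {a} {b} {s} {u} n _ f zero = solve 5 (λ a b s u f₀ →
    (a :+ con 0 :* s) :* ((b :+ con 0 :* u) :* f₀ :+ con 0) :+ con 0 :=
    (b :+ con 0 :* u) :* ((a :+ con 0 :* s) :* f₀ :+ con 0) :+ con 0) refl a b s u (f zero)
  stepₛ-comm {a} {b} {s} {u} n hyp f (suc k) = +-cancelʳ ((a + N * u) * f k) lhs rhs (begin
    lhs + (a + N * u) * f k ≈⟨ defect ⟩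
    rhs + (b + N * s) * f k ≈⟨ +-congˡ (*-congʳ hyp) ⟨
    rhs + (a + N * u) * f k ∎)
    where
    N = fromℕ n
    lhs = stepₛ a s (suc n) (stepₛ b u n f) (suc k)
    rhs = stepₛ b u (suc n) (stepₛ a s n f) (suc k)

    -- At y^(k+1) the two composites differ by ((b + n s) - (a + n u)) f_k.
    defect : lhs + (a + N * u) * f k ≈ rhs + (b + N * s) * f k
    defect = solve 9 (λ a b s u N K f₁ f₀ r →
      (a :+ (con 1 :+ K) :* s) :* ((b :+ (con 1 :+ K) :* u) :* f₁ :+ (N :+ K) :* f₀)
        :+ ((con 1 :+ N) :+ K) :* ((b :+ K :* u) :* f₀ :+ r) :+ (a :+ N :* u) :* f₀ :=
      (b :+ (con 1 :+ K) :* u) :* ((a :+ (con 1 :+ K) :* s) :* f₁ :+ (N :+ K) :* f₀)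
        :+ ((con 1 :+ N) :+ K) :* ((a :+ K :* s) :* f₀ :+ r) :+ (b :+ N :* s) :* f₀)
      refl a b s u N (fromℕ k) (f (suc k)) (f k) (raise n f k)

  +-*-cancel : ∀ b c w → b + c * w + c * - w ≈ b
  +-*-cancel b c w = trans (+-congˡ (sym (-‿distribʳ-* c w))) (//-rightDividesʳ (c * w) b)

  α-suc : ∀ x z t n → α x z t (suc n) ≈ α (x + z + t) z t n
  α-suc x z t n = solve 4 (λ x z t N →
    x :+ (con 1 :+ N) :* z :+ (con 1 :+ N) :* t := x :+ z :+ t :+ N :* z :+ N :* t) refl x z t (fromℕ n)

  α-inverse : ∀ x z t n → α (α x z t n) (- t) (- z) n ≈ x
  α-inverse x z t n = trans (+-congʳ (+-*-cancel (x + fromℕ n * z) (fromℕ n) t)) (+-*-cancel x (fromℕ n) z)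

  α+n*-z≈x+n*t : ∀ x z t n → α x z t n + fromℕ n * - z ≈ x + fromℕ n * t
  α+n*-z≈x+n*t x z t n =
    trans (+-congʳ (xy∙z≈xz∙y x (fromℕ n * z) (fromℕ n * t))) (+-*-cancel (x + fromℕ n * t) (fromℕ n) z)

  Q-recurrence′ : ∀ n x z t →
    coeff (Q (suc (suc n)) x z t) ≐ stepₛ (x + z + t) (- z) (suc n) (coeff (Q (suc n) (x + z + t) z t))
  Q-recurrence′ zero x z t k = begin
    coeff (Q 2 x z t) k                    ≈⟨ coeff-step x z t 1 (1# ∷ []) k ⟩
    stepₛ (α x z t 1) t 1 (coeff (1# ∷ [])) k ≈⟨ stepₛ-cong 1 α-one refl (λ _ → refl) k ⟩
    stepₛ (x + z + t) t 1 (coeff (1# ∷ [])) k ≈⟨ stepₛ-constant (x + z + t) t (- z) 1 1# k ⟩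
    stepₛ (x + z + t) (- z) 1 (coeff (1# ∷ [])) k ∎
    where
    α-one : α x z t 1 ≈ x + z + t
    α-one = solve 3 (λ x z t →
      x :+ (con 1 :+ con 0) :* z :+ (con 1 :+ con 0) :* t := x :+ z :+ t) refl x z t
  Q-recurrence′ (suc n) x z t k = begin
    coeff (Q (3 ℕ.+ n) x z t) k
      ≈⟨ coeff-step x z t (2 ℕ.+ n) (Q (2 ℕ.+ n) x z t) k ⟩
    stepₛ (α x z t (2 ℕ.+ n)) t (2 ℕ.+ n) (coeff (Q (2 ℕ.+ n) x z t)) k
      ≈⟨ stepₛ-cong (2 ℕ.+ n) refl refl (Q-recurrence′ n x z t) k ⟩
    stepₛ (α x z t (2 ℕ.+ n)) t (2 ℕ.+ n) (stepₛ X (- z) (suc n) f) k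
      ≈⟨ stepₛ-comm (suc n) (trans (+-congʳ (α-suc x z t (suc n))) (α+n*-z≈x+n*t X z t (suc n))) f k ⟩
    stepₛ X (- z) (2 ℕ.+ n) (stepₛ (α x z t (2 ℕ.+ n)) t (suc n) f) k
      ≈⟨ stepₛ-cong (2 ℕ.+ n) refl refl inner k ⟩
    stepₛ X (- z) (2 ℕ.+ n) (coeff (Q (2 ℕ.+ n) X z t)) k ∎
    where
    X = x + z + t
    f = coeff (Q (suc n) X z t)

    inner : stepₛ (α x z t (2 ℕ.+ n)) t (suc n) f ≐ coeff (Q (2 ℕ.+ n) X z t)
    inner i = trans (stepₛ-cong (suc n) (α-suc x z t (suc n)) refl (λ _ → refl) i)
                    (sym (coeff-step X z t (suc n) (Q (suc n) X z t) i))

  -- Stated for every x′ ≈ α x z t (suc n) so that the induction needs no congruence of Q in x.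
  Q-symmetry : ∀ n {x′} x z t → x′ ≈ α x z t (suc n) →
               coeff (Q (suc n) x z t) ≐ coeff (Q (suc n) x′ (- t) (- z))
  Q-symmetry zero          x z t _  k = refl
  Q-symmetry (suc n) {x′} x z t x′≈α k = begin
    coeff (Q (2 ℕ.+ n) x z t) k
      ≈⟨ Q-recurrence′ n x z t k ⟩
    stepₛ X (- z) (suc n) (coeff (Q (suc n) X z t)) k
      ≈⟨ stepₛ-cong (suc n) refl refl (Q-symmetry n X z t x′≈αX) k ⟩
    stepₛ X (- z) (suc n) (coeff (Q (suc n) x′ (- t) (- z))) k
      ≈⟨ stepₛ-cong (suc n) α′≈X refl (λ _ → refl) k ⟨
    stepₛ (α x′ (- t) (- z) (suc n)) (- z) (suc n) (coeff (Q (suc n) x′ (- t) (- z))) k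
      ≈⟨ coeff-step x′ (- t) (- z) (suc n) (Q (suc n) x′ (- t) (- z)) k ⟨
    coeff (Q (2 ℕ.+ n) x′ (- t) (- z)) k ∎
    where
    X = x + z + t

    x′≈αX : x′ ≈ α X z t (suc n)
    x′≈αX = trans x′≈α (α-suc x z t (suc n))

    α′≈X : α x′ (- t) (- z) (suc n) ≈ X
    α′≈X = trans (+-congʳ (+-congʳ x′≈αX)) (α-inverse X z t (suc n))

  eval-null : ∀ y f → coeff f ≐ coeff [] → eval y f ≈ 0#
  eval-null y []       f≐0 = refl
  eval-null y (a ∷ as) f≐0 = begin
    a + y * eval y as ≈⟨ +-cong (f≐0 zero) (*-congˡ (eval-null y as (λ k → f≐0 (suc k)))) ⟩
    0# + y * 0#       ≈⟨ +-identityˡ _ ⟩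
    y * 0#            ≈⟨ zeroʳ y ⟩
    0#                ∎

  eval-cong : ∀ y f g → coeff f ≐ coeff g → eval y f ≈ eval y g
  eval-cong y f        []       f≐0 = eval-null y f f≐0
  eval-cong y []       g        0≐g = sym (eval-null y g (λ k → sym (0≐g k)))
  eval-cong y (a ∷ as) (b ∷ bs) f≐g = +-cong (f≐g zero) (*-congˡ (eval-cong y as bs (λ k → f≐g (suc k))))

theorem1p1 : ∀ {c ℓ} (R : CommutativeRing c ℓ) (n : ℕ) → 1 ≤ n →
    let open CommutativeRing R
        open Poly R
    in ∀ (x y z t : Carrier) →
       eval y (Q n x z t) ≈ eval y (Q n (x + fromℕ n * z + fromℕ n * t) (- t) (- z))
theorem1p1 R zero    ()
theorem1p1 R (suc n) _ x y z t =
  eval-cong R y (Q (suc n) x z t) (Q (suc n) (α R x z t (suc n)) (- t) (- z)) (Q-symmetry R n x z t refl)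
  where open CommutativeRing R
        open Poly R
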